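{- Let $n$ and $k$ be positive integers and let $G$ be a graph in $\varGamma(n;k)$. Then $G$ is $(k+2)$-connected.
   Context: All graphs are simple, finite and undirected. The circumference $c(G)$ of a graph $G$ is the number of vertices in a longest cycle of $G$. A graph is Hamiltonian if it contains a cycle through all of its vertices. For positive integers $n$ and $k$ with $n \ge k$, $\varGamma(n;k)$ denotes the set of all graphs $G$ of order $n$ such that $c(G)=n-k$ and every induced subgraph of $G$ with $n-k$ vertices is Hamiltonian. -}

module Defs where

open import Data.Nat using (ℕ; zero; suc; _+_; _∸_; _≤_; _<_)
open import Data.Fin using (Fin; zero; suc; inject₁; fromℕ)
open import Data.Fin.Subset using (Subset; _∉_; ∣_∣)
open import Data.Bool using (Bool; true; false)
open import Data.Product using (Σ; _×_; _,_; ∃)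
open import Data.Sum using (_⊎_)
open import Data.Empty using (⊥)
open import Relation.Binary.PropositionalEquality using (_≡_)
open import Function.Definitions using (Injective)

record Graph (n : ℕ) : Set where
  field
    adj    : Fin n → Fin n → Bool
    sym    : ∀ u v → adj u v ≡ adj v u
    irrefl : ∀ v → adj v v ≡ false

open Graph public

Adj : ∀ {n} → Graph n → Fin n → Fin n → Set
Adj G u v = adj G u v ≡ true

-- Induced subgraph on the image of an injective map f : Fin m → Fin n.
induced : ∀ {n m} (G : Graph n) (f : Fin m → Fin n) → Graph m
induced G f = record
  { adj    = λ i j → adj G (f i) (f j)
  ; sym    = λ i j → sym G (f i) (f j)
  ; irrefl = λ i → irrefl G (f i)
  }

record CycleOfLength {n} (G : Graph n) (m : ℕ) : Set where
  field
    l        : ℕ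
    len      : m ≡ 3 + l
    vert     : Fin (3 + l) → Fin n
    distinct : Injective _≡_ _≡_ vert
    step     : ∀ (i : Fin (2 + l)) → Adj G (vert (inject₁ i)) (vert (suc i))
    close    : Adj G (vert (fromℕ (2 + l))) (vert zero)

HasCycle : ∀ {n} → Graph n → Set
HasCycle G = ∃ λ m → CycleOfLength G m

-- c(G) = m : m is the number of vertices of a longest cycle of G
-- (convention: c(G) = 0 when G has no cycle).
Circumference : ∀ {n} → Graph n → ℕ → Set
Circumference G m =
  (∀ m' → CycleOfLength G m' → m' ≤ m) ×
  (CycleOfLength G m ⊎ ((m ≡ 0) × (HasCycle G → ⊥)))

Hamiltonian : ∀ {n} → Graph n → Set
Hamiltonian {n} G = CycleOfLength G n

InΓ : (n k : ℕ) → Graph n → Set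
InΓ n k G =
  Circumference G (n ∸ k) ×
  (∀ (f : Fin (n ∸ k) → Fin n) → Injective _≡_ _≡_ f → Hamiltonian (induced G f))

data ReachAvoiding {n} (G : Graph n) (S : Subset n) : Fin n → Fin n → Set where
  here  : ∀ {u} → u ∉ S → ReachAvoiding G S u u
  there : ∀ {u w v} → u ∉ S → Adj G u w → ReachAvoiding G S w v →
          ReachAvoiding G S u v

Connected : ∀ {n} → ℕ → Graph n → Set
Connected {n} κ G =
  κ < n ×
  (∀ (S : Subset n) → ∣ S ∣ < κ →
     ∀ u v → u ∉ S → v ∉ S → ReachAvoiding G S u v)

{-# OPTIONS --safe #-}
module Submission where

-- Let |S| ≤ k + 1 and u, v ∉ S. Discarding all vertices of S but one leaves at
-- least n − k vertices, among them u and v; choose n − k of these including u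
-- and v. They induce a Hamiltonian subgraph whose Hamiltonian cycle passes
-- through at most one vertex of S, so what remains of the cycle joins u to v in
-- G − S. The same cycle gives n − k ≥ 3, i.e. k + 2 < n. Only the Hamiltonicity
-- condition of Γ(n;k) is needed, not the value of c(G).

open import Data.Nat using (ℕ; zero; suc; _+_; _∸_; _≤_; _<_; z≤n; s≤s; s≤s⁻¹)
open import Data.Nat.Properties
  using (≤-trans; ≰⇒>; _≤?_; n≮0; +-suc; +-comm; m≤n⇒m≤1+n; m≤m+n; m∸n≤m;
         ∸-monoʳ-≤; m≤o∸n⇒m+n≤o; m∸n≢0⇒n<m; <⇒≤; 1+n≰n; n≤1+n; module ≤-Reasoning)
open import Data.Fin as Fin using (Fin; zero; suc; inject₁; fromℕ; inject≤; lift; punchOut)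
open import Data.Fin.Properties
  using (suc-injective; lift-injective; inject≤-injective; punchOut-injective;
         injective⇒≤; any?)
  renaming (_≟_ to _≟ᶠ_; _≤?_ to _≤ᶠ?_; ≤-antisym to ≤ᶠ-antisym)
open import Data.Fin.Subset
  using (Subset; inside; outside; _∈_; _∉_; _⊆_; ∣_∣; ⊤; ∁; _-_; _∪_; ⁅_⁆)
open import Data.Fin.Subset.Properties
  using (_∈?_; drop-∷-⊆; p⊆q⇒∣p∣≤∣q∣; x∈p⇒∣p-x∣<∣p∣; nonempty?; ∈⊤; ∣⊤∣≡n;
         ∣∁p∣≡n∸∣p∣; x∉p⇒x∈∁p; p⊆q⇒∁p⊇∁q; x∈∁p⇒x∉p; p─q⊆p; x∈p∧x≢y⇒x∈p-y;
         x∈p∪q⁻; x∈p∪q⁺; x∈⁅x⁆; x∈⁅y⁆⇒x≡y; ∣⁅x⁆∣≡1)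
open import Data.Vec using (_∷_; [])
open import Data.Vec.Base using (_[_]=_)
open _[_]=_
open import Data.Product using (_×_; _,_; ∃)
open import Data.Sum using (_⊎_; inj₁; inj₂)
open import Relation.Nullary using (yes; no; ¬_; contradiction)
open import Relation.Nullary.Decidable using (_×-dec_)
open import Relation.Binary.PropositionalEquality
  using (_≡_; refl; sym; trans; cong; cong₂; subst; subst₂)
open import Function using (_∘_)
open import Function.Definitions using (Injective)

open import Defs hiding (sym)

injective⇒surjective : ∀ {m} (f : Fin m → Fin m) → Injective _≡_ _≡_ f →
  ∀ y → ∃ λ x → f x ≡ y
injective⇒surjective {suc m} f f-inj y with any? (λ x → f x ≟ᶠ y)
... | yes preimage = preimage
-- Otherwise f misses y, and punching y out of its values injects Fin (suc m) into Fin m.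
... | no ∄x = contradiction (injective⇒≤ g-inj) (1+n≰n)
  where
  y≢f : ∀ x → ¬ y ≡ f x
  y≢f x y≡fx = ∄x (x , sym y≡fx)

  g : Fin (suc m) → Fin m
  g x = punchOut (y≢f x)

  g-inj : Injective _≡_ _≡_ g
  g-inj {x} {x′} = f-inj ∘ punchOut-injective (y≢f x) (y≢f x′)

∣p∪q∣≤∣p∣+∣q∣ : ∀ {n} (p q : Subset n) → ∣ p ∪ q ∣ ≤ ∣ p ∣ + ∣ q ∣
∣p∪q∣≤∣p∣+∣q∣ []            []            = z≤n
∣p∪q∣≤∣p∣+∣q∣ (outside ∷ p) (outside ∷ q) = ∣p∪q∣≤∣p∣+∣q∣ p q
∣p∪q∣≤∣p∣+∣q∣ (inside  ∷ p) (outside ∷ q) = s≤s (∣p∪q∣≤∣p∣+∣q∣ p q)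
∣p∪q∣≤∣p∣+∣q∣ (outside ∷ p) (inside  ∷ q) =
  subst (suc ∣ p ∪ q ∣ ≤_) (sym (+-suc ∣ p ∣ ∣ q ∣)) (s≤s (∣p∪q∣≤∣p∣+∣q∣ p q))
∣p∪q∣≤∣p∣+∣q∣ (inside  ∷ p) (inside  ∷ q) =
  s≤s (subst (∣ p ∪ q ∣ ≤_) (sym (+-suc ∣ p ∣ ∣ q ∣)) (m≤n⇒m≤1+n (∣p∪q∣≤∣p∣+∣q∣ p q)))

record Selection {n} (m : ℕ) (A T : Subset n) : Set where
  field
    pick           : Fin m → Fin n
    pick-injective : Injective _≡_ _≡_ pick
    pick∈T         : ∀ i → pick i ∈ T
    pick-covers    : ∀ {x} → x ∈ A → ∃ λ i → pick i ≡ x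

module _ {n m} {A T : Subset n} (σ : Selection m A T) where
  open Selection σ

  take-head : ∀ {a} → Selection (suc m) (a ∷ A) (inside ∷ T)
  take-head = record
    { pick           = lift 1 pick
    ; pick-injective = lift-injective pick pick-injective 1
    ; pick∈T         = in-T
    ; pick-covers    = covers
    }
    where
    in-T : ∀ i → lift 1 pick i ∈ inside ∷ T
    in-T zero    = here
    in-T (suc i) = there (pick∈T i)

    covers : ∀ {a x} → x ∈ a ∷ A → ∃ λ i → lift 1 pick i ≡ x
    covers {x = zero}  _           = zero , refl
    covers {x = suc x} (there x∈A) with pick-covers x∈A
    ... | i , refl = suc i , refl

  skip-head : ∀ {t} → Selection m (outside ∷ A) (t ∷ T)
  skip-head = record
    { pick           = suc ∘ pick
    ; pick-injective = pick-injective ∘ suc-injective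
    ; pick∈T         = there ∘ pick∈T
    ; pick-covers    = covers
    }
    where
    covers : ∀ {x} → x ∈ outside ∷ A → ∃ λ i → suc (pick i) ≡ x
    covers (there x∈A) with pick-covers x∈A
    ... | i , refl = i , refl

select : ∀ {n} m (A T : Subset n) → A ⊆ T → ∣ A ∣ ≤ m → m ≤ ∣ T ∣ → Selection m A T
select zero A T _ ∣A∣≤0 _ = record
  { pick           = λ ()
  ; pick-injective = λ {}
  ; pick∈T         = λ ()
  ; pick-covers    = λ x∈A → contradiction (≤-trans (x∈p⇒∣p-x∣<∣p∣ x∈A) ∣A∣≤0) n≮0
  }
select (suc m) [] [] _ _ ()
select (suc m) (inside ∷ A) (outside ∷ T) A⊆T _ _ = contradiction (A⊆T here) (λ ())
select (suc m) (inside ∷ A) (inside ∷ T) A⊆T (s≤s ∣A∣≤m) (s≤s m≤∣T∣) =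
  take-head (select m A T (drop-∷-⊆ A⊆T) ∣A∣≤m m≤∣T∣)
select (suc m) (outside ∷ A) (outside ∷ T) A⊆T ∣A∣≤1+m 1+m≤∣T∣ =
  skip-head (select (suc m) A T (drop-∷-⊆ A⊆T) ∣A∣≤1+m 1+m≤∣T∣)
select (suc m) (outside ∷ A) (inside ∷ T) A⊆T ∣A∣≤1+m (s≤s m≤∣T∣) with ∣ A ∣ ≤? m
... | yes ∣A∣≤m = take-head (select m A T (drop-∷-⊆ A⊆T) ∣A∣≤m m≤∣T∣)
... | no  ∣A∣≰m = skip-head (select (suc m) A T (drop-∷-⊆ A⊆T) ∣A∣≤1+m
                    (≤-trans (≰⇒> ∣A∣≰m) (p⊆q⇒∣p∣≤∣q∣ (drop-∷-⊆ A⊆T))))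

HitsAtMostOnce : ∀ {n m} → Subset n → (Fin m → Fin n) → Set
HitsAtMostOnce S c = ∀ {i j} → c i ∈ S → c j ∈ S → i ≡ j

MeetsAtMostOnce : ∀ {n} → Subset n → Subset n → Set
MeetsAtMostOnce S T = ∀ {x y} → x ∈ T → x ∈ S → y ∈ T → y ∈ S → x ≡ y

∁-plus-at-most-one : ∀ {n} k (S : Subset n) → ∣ S ∣ ≤ suc k →
  ∃ λ T → ∁ S ⊆ T × n ∸ k ≤ ∣ T ∣ × MeetsAtMostOnce S T
∁-plus-at-most-one {n} k S ∣S∣≤1+k with nonempty? S
... | no ∄s = ⊤ , (λ _ → ∈⊤) , subst (n ∸ k ≤_) (sym (∣⊤∣≡n n)) (m∸n≤m n k) ,
              (λ {x} _ x∈S _ _ → contradiction (x , x∈S) ∄s)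
... | yes (s , s∈S) = ∁ (S - s) , p⊆q⇒∁p⊇∁q (p─q⊆p S ⁅ s ⁆) , size ,
                      (λ x∈T x∈S y∈T y∈S → trans (is-s x∈T x∈S) (sym (is-s y∈T y∈S)))
  where
  size : n ∸ k ≤ ∣ ∁ (S - s) ∣
  size = subst (n ∸ k ≤_) (sym (∣∁p∣≡n∸∣p∣ (S - s)))
           (∸-monoʳ-≤ n (s≤s⁻¹ (≤-trans (x∈p⇒∣p-x∣<∣p∣ s∈S) ∣S∣≤1+k)))

  is-s : ∀ {x} → x ∈ ∁ (S - s) → x ∈ S → x ≡ s
  is-s {x} x∈T x∈S with x ≟ᶠ s
  ... | yes x≡s = x≡s
  ... | no  x≢s = contradiction (x∈p∧x≢y⇒x∈p-y x∈S x≢s) (x∈∁p⇒x∉p x∈T)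

3≤n∸k⇒k+2<n : ∀ {n k} → 3 ≤ n ∸ k → k + 2 < n
3≤n∸k⇒k+2<n {n} {k} 3≤n∸k =
  subst (_≤ n) (cong suc (+-comm 2 k)) (m≤o∸n⇒m+n≤o 3 k≤n 3≤n∸k)
  where
  k≤n : k ≤ n
  k≤n = <⇒≤ (m∸n≢0⇒n<m (λ n∸k≡0 → contradiction (subst (3 ≤_) n∸k≡0 3≤n∸k) λ ()))

Adj-sym : ∀ {n} (G : Graph n) {u v} → Adj G u v → Adj G v u
Adj-sym G {u} {v} uv = trans (Graph.sym G v u) uv

IsWalk : ∀ {n K} → Graph n → (Fin (suc K) → Fin n) → Set
IsWalk {K = K} G p = ∀ (i : Fin K) → Adj G (p (inject₁ i)) (p (suc i))

module _ {n} (G : Graph n) (S : Subset n) where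

  private
    R : Fin n → Fin n → Set
    R = ReachAvoiding G S

  reach-trans : ∀ {u v w} → R u v → R v w → R u w
  reach-trans (here _)         vw = vw
  reach-trans (there u∉S a uv) vw = there u∉S a (reach-trans uv vw)

  reach-source∉ : ∀ {u v} → R u v → u ∉ S
  reach-source∉ (here u∉S)      = u∉S
  reach-source∉ (there u∉S _ _) = u∉S

  reach-sym : ∀ {u v} → R u v → R v u
  reach-sym (here u∉S)       = here u∉S
  reach-sym (there u∉S a wv) =
    reach-trans (reach-sym wv) (there (reach-source∉ wv) (Adj-sym G a) (here u∉S))

  reach-target∉ : ∀ {u v} → R u v → v ∉ S
  reach-target∉ = reach-source∉ ∘ reach-sym

  walk-reach-prefix : ∀ {K} (p : Fin (suc K) → Fin n) → IsWalk G p →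
    ∀ i → (∀ j → j Fin.≤ i → p j ∉ S) → R (p zero) (p i)
  walk-reach-prefix p w zero    avoid = here (avoid zero z≤n)
  walk-reach-prefix {suc K} p w (suc i) avoid =
    there (avoid zero z≤n) (w zero)
      (walk-reach-prefix (p ∘ suc) (w ∘ suc) i (λ j j≤i → avoid (suc j) (s≤s j≤i)))

  walk-reach-suffix : ∀ {K} (p : Fin (suc K) → Fin n) → IsWalk G p →
    ∀ i → (∀ j → i Fin.≤ j → p j ∉ S) → R (p i) (p (fromℕ K))
  walk-reach-suffix p w zero avoid = walk-reach-prefix p w _ (λ j _ → avoid j z≤n)
  walk-reach-suffix {suc K} p w (suc i) avoid =
    walk-reach-suffix (p ∘ suc) (w ∘ suc) i (λ j i≤j → avoid (suc j) (s≤s i≤j))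

  -- A vertex of the closed walk outside S cannot have the unique S-vertex of
  -- the walk both before and after it, so it reaches one of the two ends.
  closedWalk-reach : ∀ {K} (c : Fin (suc K) → Fin n) → IsWalk G c →
    Adj G (c (fromℕ K)) (c zero) → HitsAtMostOnce S c →
    ∀ {a b} → c a ∉ S → c b ∉ S → R (c a) (c b)
  closedWalk-reach {K} c walk close once {a} {b} ca∉S cb∉S =
    join (reach-end ca∉S) (reach-end cb∉S)
    where
    first last : Fin n
    first = c zero
    last  = c (fromℕ K)

    ends : ∀ {x y} → R x last → R y first → R last first
    ends xK y0 = there (reach-target∉ xK) close (here (reach-target∉ y0))

    join : R (c a) first ⊎ R (c a) last → R (c b) first ⊎ R (c b) last → R (c a) (c b)
    join (inj₁ a0) (inj₁ b0) = reach-trans a0 (reach-sym b0)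
    join (inj₂ aK) (inj₂ bK) = reach-trans aK (reach-sym bK)
    join (inj₁ a0) (inj₂ bK) = reach-trans a0 (reach-trans (reach-sym (ends bK a0)) (reach-sym bK))
    join (inj₂ aK) (inj₁ b0) = reach-trans aK (reach-trans (ends aK b0) (reach-sym b0))

    reach-end : ∀ {x} → c x ∉ S → R (c x) first ⊎ R (c x) last
    reach-end {x} cx∉S with any? (λ j → (j ≤ᶠ? x) ×-dec (c j ∈? S))
    ... | no ∄j = inj₁ (reach-sym (walk-reach-prefix c walk x
                          (λ j j≤x cj∈S → ∄j (j , j≤x , cj∈S))))
    ... | yes (j , j≤x , cj∈S) = inj₂ (walk-reach-suffix c walk x
                          (λ j′ x≤j′ cj′∈S → cx∉S (subst (λ y → c y ∈ S)
                            (≤ᶠ-antisym j≤x (subst (x Fin.≤_) (once cj′∈S cj∈S) x≤j′)) cj∈S)))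

cycle-length≥3 : ∀ {n m} {G : Graph n} → CycleOfLength G m → 3 ≤ m
cycle-length≥3 record { l = l ; len = refl } = m≤m+n 3 l

hamiltonian-induced⇒reach : ∀ {n m} (G : Graph n) (S : Subset n) (f : Fin m → Fin n) →
  HitsAtMostOnce S f → Hamiltonian (induced G f) →
  ∀ {i j} → f i ∉ S → f j ∉ S → ReachAvoiding G S (f i) (f j)
hamiltonian-induced⇒reach G S f once
  record { len = refl ; vert = vert ; distinct = distinct ; step = step ; close = close }
  {i} {j}
  with injective⇒surjective vert distinct i | injective⇒surjective vert distinct j
... | a , refl | b , refl =
  closedWalk-reach G S (f ∘ vert) step close (λ p q → distinct (once p q))

hamiltonian-subgraphs⇒reach : ∀ {n m} (G : Graph n) (S T : Subset n) →
  m ≤ ∣ T ∣ → 2 ≤ m → MeetsAtMostOnce S T →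
  (∀ (f : Fin m → Fin n) → Injective _≡_ _≡_ f → Hamiltonian (induced G f)) →
  ∀ {u v} → u ∈ T → v ∈ T → u ∉ S → v ∉ S → ReachAvoiding G S u v
hamiltonian-subgraphs⇒reach {m = m} G S T m≤∣T∣ 2≤m once ham {u} {v} u∈T v∈T u∉S v∉S =
  connect (pick-covers (x∈p∪q⁺ (inj₁ (x∈⁅x⁆ u)))) (pick-covers (x∈p∪q⁺ (inj₂ (x∈⁅x⁆ v))))
  where
  pair⊆T : ⁅ u ⁆ ∪ ⁅ v ⁆ ⊆ T
  pair⊆T x∈pair with x∈p∪q⁻ ⁅ u ⁆ ⁅ v ⁆ x∈pair
  ... | inj₁ x∈⁅u⁆ = subst (_∈ T) (sym (x∈⁅y⁆⇒x≡y u x∈⁅u⁆)) u∈T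
  ... | inj₂ x∈⁅v⁆ = subst (_∈ T) (sym (x∈⁅y⁆⇒x≡y v x∈⁅v⁆)) v∈T

  ∣pair∣≤m : ∣ ⁅ u ⁆ ∪ ⁅ v ⁆ ∣ ≤ m
  ∣pair∣≤m = begin
    ∣ ⁅ u ⁆ ∪ ⁅ v ⁆ ∣     ≤⟨ ∣p∪q∣≤∣p∣+∣q∣ ⁅ u ⁆ ⁅ v ⁆ ⟩
    ∣ ⁅ u ⁆ ∣ + ∣ ⁅ v ⁆ ∣ ≡⟨ cong₂ _+_ (∣⁅x⁆∣≡1 u) (∣⁅x⁆∣≡1 v) ⟩
    2                     ≤⟨ 2≤m ⟩
    m                     ∎
    where open ≤-Reasoning

  open Selection (select m (⁅ u ⁆ ∪ ⁅ v ⁆) T pair⊆T ∣pair∣≤m m≤∣T∣)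

  pick-once : HitsAtMostOnce S pick
  pick-once p∈S q∈S = pick-injective (once (pick∈T _) p∈S (pick∈T _) q∈S)

  connect : ∃ (λ i → pick i ≡ u) → ∃ (λ j → pick j ≡ v) → ReachAvoiding G S u v
  connect (i , pick-i≡u) (j , pick-j≡v) =
    subst₂ (ReachAvoiding G S) pick-i≡u pick-j≡v
      (hamiltonian-induced⇒reach G S pick pick-once (ham pick pick-injective)
        (subst (_∉ S) (sym pick-i≡u) u∉S) (subst (_∉ S) (sym pick-j≡v) v∉S))

mainTheorem6 : ∀ (n k : ℕ) → 1 ≤ n → 1 ≤ k →
    (G : Graph n) → InΓ n k G → Connected (k + 2) G
mainTheorem6 n k _ _ G (_ , ham) = 3≤n∸k⇒k+2<n 3≤n∸k , separated
  where
  3≤n∸k : 3 ≤ n ∸ k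
  3≤n∸k = cycle-length≥3 (ham (λ i → inject≤ i (m∸n≤m n k)) (inject≤-injective _ _ _ _))

  separated : ∀ S → ∣ S ∣ < k + 2 → ∀ u v → u ∉ S → v ∉ S → ReachAvoiding G S u v
  separated S ∣S∣<k+2 u v u∉S v∉S
    with ∁-plus-at-most-one k S (s≤s⁻¹ (subst (∣ S ∣ <_) (+-comm k 2) ∣S∣<k+2))
  ... | T , ∁S⊆T , n∸k≤∣T∣ , once =
    hamiltonian-subgraphs⇒reach G S T n∸k≤∣T∣ (≤-trans (n≤1+n 2) 3≤n∸k) once ham
      (∁S⊆T (x∉p⇒x∈∁p u∉S)) (∁S⊆T (x∉p⇒x∈∁p v∉S)) u∉S v∉S
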